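{- For all positive integers $n$ and $r$, $$\begin{aligned}F(n,r)=&\,4F(n-1,r)-\sum_{i=0}^{r-1}\binom{2r}{2i}F(n,i)-2(2n-1)\sum_{i=0}^{r-1}\binom{2r}{2i+1}F(n-1,i)\\&+n\sum_{i=0}^{r-1}\binom{2r}{2i+1}F(n,i)+2\sum_{i=0}^{r-1}\binom{2r}{2i}F(n-1,i),\end{aligned}$$ where $F(n,r)=\sum_{k=-n}^{n}\binom{2n}{n-k}k^{2r}$ for nonnegative integers $n,r$.
   Context: The convention $0^0=1$ is used in the definition of $F$. -}

module Defs where

open import Data.Nat as ℕ using (ℕ; zero; suc)
open import Data.Nat.Combinatorics using (_C_)
open import Data.Integer as ℤ using (ℤ; +_; _+_; _*_; _-_; -_; ∣_∣)
open import Data.Integer using () renaming (_^_ to _^ℤ_)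

sumTo : ℕ → (ℕ → ℤ) → ℤ
sumTo zero    f = + 0
sumTo (suc m) f = sumTo m f + f m

sumFrom : ℤ → ℕ → (ℤ → ℤ) → ℤ
sumFrom a zero      f = + 0
sumFrom a (suc len) f = f a + sumFrom (a + + 1) len f

sumSym : ℕ → (ℤ → ℤ) → ℤ
sumSym n f = sumFrom (- (+ n)) (suc (2 ℕ.* n)) f

-- binomial coefficient with integer lower index; only used with 0 ≤ n-k
binomℤ : ℕ → ℤ → ℤ
binomℤ m (+ j)     = + (m C j)
binomℤ m ℤ.-[1+ _ ] = + 0

-- F(n,r) = Σ_{k=-n}^{n} C(2n, n-k) k^{2r}   (Agda's _^_ gives 0^0 = 1)
F : ℕ → ℕ → ℤ
F n r = sumSym n (λ k → binomℤ (2 ℕ.* n) (+ n - k) * (k ^ℤ (2 ℕ.* r)))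

module Submission where

-- Write F(n,r) = Σₖ C(2n,n+k) k^{2r} as a moment centralSum n of the symmetric
-- binomial weights. Pascal's rule applied twice gives
-- centralSum (n+1) p = centralSum n (p(k−1) + 2p(k) + p(k+1)), and the absorption
-- identity j C(N,j) = N C(N−1,j−1) gives rules for the moments of k·p and k²·p;
-- odd functions have vanishing moments. Expanding (k ± 1)^{2r} = k^{2r} + E(k) ± k·O(k),
-- the first rule yields F(n,r) = 4F(n−1,r) + 2 Σᵢ C(2r,2i) F(n−1,i), and evaluating
-- the moment of k²·O in two ways yields
-- n Σᵢ C(2r,2i+1) F(n,i) = Σᵢ C(2r,2i) F(n,i) + 2(2n−1) Σᵢ C(2r,2i+1) F(n−1,i).
-- The stated recurrence is the first identity plus the difference of the sides of the second.

open import Defs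
open import Data.Nat as ℕ using (ℕ; suc; zero)
open import Data.Nat.Combinatorics using (_C_; nCk+nC[k+1]≡[n+1]C[k+1]; k>n⇒nCk≡0; nCn≡1; nCk≡nC[n∸k])
open import Data.Integer using (ℤ; +_; -[1+_]; _+_; _*_; _-_; -_)
open import Data.Integer using () renaming (_^_ to _^ℤ_)
import Data.Integer.Properties as ℤP
import Data.Nat.Properties as ℕP
open import Function using (_∘_)
open import Relation.Binary.PropositionalEquality
open import Data.Integer.Tactic.RingSolver using (solve-∀)

sumTo-cong : ∀ n {f g : ℕ → ℤ} → (∀ j → f j ≡ g j) → sumTo n f ≡ sumTo n g
sumTo-cong zero    eq = refl
sumTo-cong (suc n) eq = cong₂ _+_ (sumTo-cong n eq) (eq n)

sumTo-cong-< : ∀ n {f g : ℕ → ℤ} → (∀ j → j ℕ.< n → f j ≡ g j) → sumTo n f ≡ sumTo n g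
sumTo-cong-< zero    eq = refl
sumTo-cong-< (suc n) eq =
  cong₂ _+_ (sumTo-cong-< n (λ j j<n → eq j (ℕP.m<n⇒m<1+n j<n))) (eq n (ℕP.n<1+n n))

sumTo-+ : ∀ n (f g : ℕ → ℤ) → sumTo n (λ j → f j + g j) ≡ sumTo n f + sumTo n g
sumTo-+ zero    f g = refl
sumTo-+ (suc n) f g =
  trans (cong (_+ (f n + g n)) (sumTo-+ n f g)) (interchange (sumTo n f) (sumTo n g) (f n) (g n))
  where
  interchange : ∀ a b c d → a + b + (c + d) ≡ a + c + (b + d)
  interchange = solve-∀

sumTo-- : ∀ n (f g : ℕ → ℤ) → sumTo n (λ j → f j - g j) ≡ sumTo n f - sumTo n g
sumTo-- zero    f g = refl
sumTo-- (suc n) f g =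
  trans (cong (_+ (f n - g n)) (sumTo-- n f g)) (interchange (sumTo n f) (sumTo n g) (f n) (g n))
  where
  interchange : ∀ a b c d → a - b + (c - d) ≡ a + c - (b + d)
  interchange = solve-∀

sumTo-* : ∀ n c (f : ℕ → ℤ) → sumTo n (λ j → c * f j) ≡ c * sumTo n f
sumTo-* zero    c f = sym (ℤP.*-zeroʳ c)
sumTo-* (suc n) c f =
  trans (cong (_+ c * f n) (sumTo-* n c f)) (sym (ℤP.*-distribˡ-+ c (sumTo n f) (f n)))

sumTo-shift : ∀ n (f : ℕ → ℤ) → sumTo (suc n) f ≡ f 0 + sumTo n (f ∘ suc)
sumTo-shift zero    f = trans (ℤP.+-identityˡ (f 0)) (sym (ℤP.+-identityʳ (f 0)))
sumTo-shift (suc n) f =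
  trans (cong (_+ f (suc n)) (sumTo-shift n f)) (ℤP.+-assoc (f 0) _ (f (suc n)))

sumTo-pairs : ∀ r (h : ℕ → ℤ) → sumTo (2 ℕ.* r) h ≡ sumTo r (λ i → h (2 ℕ.* i) + h (suc (2 ℕ.* i)))
sumTo-pairs zero    h = refl
sumTo-pairs (suc r) h = begin
    sumTo (2 ℕ.* suc r) h
  ≡⟨ cong (λ N → sumTo N h) (ℕP.*-suc 2 r) ⟩
    sumTo (2 ℕ.* r) h + h (2 ℕ.* r) + h (suc (2 ℕ.* r))
  ≡⟨ ℤP.+-assoc (sumTo (2 ℕ.* r) h) _ _ ⟩
    sumTo (2 ℕ.* r) h + (h (2 ℕ.* r) + h (suc (2 ℕ.* r)))
  ≡⟨ cong (_+ (h (2 ℕ.* r) + h (suc (2 ℕ.* r)))) (sumTo-pairs r h) ⟩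
    sumTo (suc r) (λ i → h (2 ℕ.* i) + h (suc (2 ℕ.* i)))
  ∎
  where open ≡-Reasoning

sumFrom≡sumTo : ∀ a len (g : ℤ → ℤ) → sumFrom a len g ≡ sumTo len (λ j → g (a + + j))
sumFrom≡sumTo a zero      g = refl
sumFrom≡sumTo a (suc len) g = begin
    g a + sumFrom (a + + 1) len g
  ≡⟨ cong₂ _+_ (cong g (sym (ℤP.+-identityʳ a))) (sumFrom≡sumTo (a + + 1) len g) ⟩
    g (a + + 0) + sumTo len (λ j → g (a + + 1 + + j))
  ≡⟨ cong (λ t → g (a + + 0) + t) (sumTo-cong len (λ j → cong g (ℤP.+-assoc a (+ 1) (+ j)))) ⟩
    g (a + + 0) + sumTo len (λ j → g (a + + suc j))
  ≡⟨ sym (sumTo-shift len (λ j → g (a + + j))) ⟩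
    sumTo (suc len) (λ j → g (a + + j))
  ∎
  where open ≡-Reasoning

binomialSum : ℕ → (ℕ → ℤ) → ℤ
binomialSum N f = sumTo (suc N) (λ j → + (N C j) * f j)

binomialSum-cong : ∀ N {f g : ℕ → ℤ} → (∀ j → f j ≡ g j) → binomialSum N f ≡ binomialSum N g
binomialSum-cong N eq = sumTo-cong (suc N) (λ j → cong (+ (N C j) *_) (eq j))

binomialSum-+ : ∀ N (f g : ℕ → ℤ) → binomialSum N (λ j → f j + g j) ≡ binomialSum N f + binomialSum N g
binomialSum-+ N f g = trans (sumTo-cong (suc N) (λ j → ℤP.*-distribˡ-+ (+ (N C j)) (f j) (g j))) (sumTo-+ (suc N) _ _)

binomialSum-- : ∀ N (f g : ℕ → ℤ) → binomialSum N (λ j → f j - g j) ≡ binomialSum N f - binomialSum N g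
binomialSum-- N f g = trans (sumTo-cong (suc N) (λ j → distrib (+ (N C j)) (f j) (g j))) (sumTo-- (suc N) _ _)
  where
  distrib : ∀ a b c → a * (b - c) ≡ a * b - a * c
  distrib = solve-∀

binomialSum-* : ∀ N c (f : ℕ → ℤ) → binomialSum N (λ j → c * f j) ≡ c * binomialSum N f
binomialSum-* N c f = trans (sumTo-cong (suc N) (λ j → swap (+ (N C j)) c (f j))) (sumTo-* (suc N) c _)
  where
  swap : ∀ a b c → a * (b * c) ≡ b * (a * c)
  swap = solve-∀

binomialSum-pascal : ∀ N f → binomialSum (suc N) f ≡ binomialSum N f + binomialSum N (f ∘ suc)
binomialSum-pascal N f = begin
    binomialSum (suc N) f
  ≡⟨ sumTo-shift (suc N) _ ⟩
    + 1 * f 0 + sumTo (suc N) (λ j → + (suc N C suc j) * f (suc j))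
  ≡⟨ cong (λ t → + 1 * f 0 + t) (trans (sumTo-cong (suc N) pascal-rule) (sumTo-+ (suc N) _ _)) ⟩
    + 1 * f 0 + (binomialSum N (f ∘ suc) + (tail + + (N C suc N) * f (suc N)))
  ≡⟨ cong (λ c → + 1 * f 0 + (binomialSum N (f ∘ suc) + (tail + + c * f (suc N)))) (k>n⇒nCk≡0 (ℕP.n<1+n N)) ⟩
    + 1 * f 0 + (binomialSum N (f ∘ suc) + (tail + + 0 * f (suc N)))
  ≡⟨ regroup (+ 1 * f 0) (binomialSum N (f ∘ suc)) tail (f (suc N)) ⟩
    (+ 1 * f 0 + tail) + binomialSum N (f ∘ suc)
  ≡⟨ cong (_+ binomialSum N (f ∘ suc)) (sym (sumTo-shift N _)) ⟩
    binomialSum N f + binomialSum N (f ∘ suc)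
  ∎
  where
  open ≡-Reasoning
  tail = sumTo N (λ j → + (N C suc j) * f (suc j))
  pascal-rule : ∀ j → + (suc N C suc j) * f (suc j) ≡ + (N C j) * f (suc j) + + (N C suc j) * f (suc j)
  pascal-rule j = begin
      + (suc N C suc j) * f (suc j)
    ≡⟨ cong (λ c → + c * f (suc j)) (sym (nCk+nC[k+1]≡[n+1]C[k+1] N j)) ⟩
      + (N C j ℕ.+ N C suc j) * f (suc j)
    ≡⟨ cong (_* f (suc j)) (ℤP.pos-+ (N C j) (N C suc j)) ⟩
      (+ (N C j) + + (N C suc j)) * f (suc j)
    ≡⟨ ℤP.*-distribʳ-+ (f (suc j)) (+ (N C j)) (+ (N C suc j)) ⟩
      + (N C j) * f (suc j) + + (N C suc j) * f (suc j)
    ∎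
  regroup : ∀ a b t x → a + (b + (t + + 0 * x)) ≡ (a + t) + b
  regroup = solve-∀

binomialSum-pascal² : ∀ N f →
  binomialSum (suc (suc N)) f ≡ binomialSum N f + + 2 * binomialSum N (f ∘ suc) + binomialSum N (f ∘ suc ∘ suc)
binomialSum-pascal² N f = begin
    binomialSum (suc (suc N)) f
  ≡⟨ binomialSum-pascal (suc N) f ⟩
    binomialSum (suc N) f + binomialSum (suc N) (f ∘ suc)
  ≡⟨ cong₂ _+_ (binomialSum-pascal N f) (binomialSum-pascal N (f ∘ suc)) ⟩
    (a + b) + (b + c)
  ≡⟨ collect a b c ⟩
    a + + 2 * b + c
  ∎
  where
  open ≡-Reasoning
  a = binomialSum N f
  b = binomialSum N (f ∘ suc)
  c = binomialSum N (f ∘ suc ∘ suc)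
  collect : ∀ a b c → (a + b) + (b + c) ≡ a + + 2 * b + c
  collect = solve-∀

binomialSum-absorb : ∀ N f → binomialSum (suc N) (λ j → + j * f j) ≡ + suc N * binomialSum N (f ∘ suc)
binomialSum-absorb zero    f = base (f 0) (f 1)
  where
  base : ∀ a b → + 0 + + 1 * (+ 0 * a) + + 1 * (+ 1 * b) ≡ + 1 * (+ 0 + + 1 * b)
  base = solve-∀
binomialSum-absorb (suc N) f = begin
    binomialSum (suc (suc N)) (λ j → + j * f j)
  ≡⟨ binomialSum-pascal (suc N) (λ j → + j * f j) ⟩
    binomialSum (suc N) (λ j → + j * f j) + binomialSum (suc N) (λ j → + suc j * f (suc j))
  ≡⟨ cong (λ t → binomialSum (suc N) (λ j → + j * f j) + t) shifted ⟩
    binomialSum (suc N) (λ j → + j * f j) + (binomialSum (suc N) (λ j → + j * f (suc j)) + binomialSum (suc N) (f ∘ suc))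
  ≡⟨ cong₂ (λ x y → x + (y + binomialSum (suc N) (f ∘ suc))) (binomialSum-absorb N f) (binomialSum-absorb N (f ∘ suc)) ⟩
    + suc N * a + (+ suc N * b + binomialSum (suc N) (f ∘ suc))
  ≡⟨ cong (λ t → + suc N * a + (+ suc N * b + t)) (binomialSum-pascal N (f ∘ suc)) ⟩
    + suc N * a + (+ suc N * b + (a + b))
  ≡⟨ collect (+ suc N) a b ⟩
    + suc (suc N) * (a + b)
  ≡⟨ cong (+ suc (suc N) *_) (sym (binomialSum-pascal N (f ∘ suc))) ⟩
    + suc (suc N) * binomialSum (suc N) (f ∘ suc)
  ∎
  where
  open ≡-Reasoning
  a = binomialSum N (f ∘ suc)
  b = binomialSum N (f ∘ suc ∘ suc)
  shifted : binomialSum (suc N) (λ j → + suc j * f (suc j))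
          ≡ binomialSum (suc N) (λ j → + j * f (suc j)) + binomialSum (suc N) (f ∘ suc)
  shifted = trans (binomialSum-cong (suc N) (λ j → split (+ j) (f (suc j)))) (binomialSum-+ (suc N) _ _)
    where
    split : ∀ x y → (+ 1 + x) * y ≡ x * y + y
    split = solve-∀
  collect : ∀ x a b → x * a + (x * b + (a + b)) ≡ (+ 1 + x) * (a + b)
  collect = solve-∀

binomialSum-absorbʳ : ∀ M f → binomialSum (suc M) (λ j → (+ suc M - + j) * f j) ≡ + suc M * binomialSum M f
binomialSum-absorbʳ M f = begin
    binomialSum (suc M) (λ j → (+ suc M - + j) * f j)
  ≡⟨ binomialSum-cong (suc M) (λ j → distrib (+ suc M) (+ j) (f j)) ⟩
    binomialSum (suc M) (λ j → + suc M * f j - + j * f j)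
  ≡⟨ binomialSum-- (suc M) _ _ ⟩
    binomialSum (suc M) (λ j → + suc M * f j) - binomialSum (suc M) (λ j → + j * f j)
  ≡⟨ cong₂ _-_ (binomialSum-* (suc M) (+ suc M) f) (binomialSum-absorb M f) ⟩
    + suc M * binomialSum (suc M) f - + suc M * binomialSum M (f ∘ suc)
  ≡⟨ cong (λ t → + suc M * t - + suc M * binomialSum M (f ∘ suc)) (binomialSum-pascal M f) ⟩
    + suc M * (binomialSum M f + binomialSum M (f ∘ suc)) - + suc M * binomialSum M (f ∘ suc)
  ≡⟨ cancel (+ suc M) (binomialSum M f) (binomialSum M (f ∘ suc)) ⟩
    + suc M * binomialSum M f
  ∎
  where
  open ≡-Reasoning
  distrib : ∀ x y z → (x - y) * z ≡ x * z - y * z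
  distrib = solve-∀
  cancel : ∀ x a b → x * (a + b) - x * b ≡ x * a
  cancel = solve-∀

binomialSum-falling : ∀ N f →
  binomialSum (suc (suc N)) (λ j → + j * ((+ suc (suc N) - + j) * f j)) ≡ + suc (suc N) * + suc N * binomialSum N (f ∘ suc)
binomialSum-falling N f = begin
    binomialSum (suc (suc N)) (λ j → + j * ((+ suc (suc N) - + j) * f j))
  ≡⟨ binomialSum-absorb (suc N) (λ j → (+ suc (suc N) - + j) * f j) ⟩
    + suc (suc N) * binomialSum (suc N) (λ j → (+ suc (suc N) - + suc j) * f (suc j))
  ≡⟨ cong (+ suc (suc N) *_) (binomialSum-cong (suc N) (λ j → cong (_* f (suc j)) (cancel (+ suc N) (+ j)))) ⟩
    + suc (suc N) * binomialSum (suc N) (λ j → (+ suc N - + j) * f (suc j))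
  ≡⟨ cong (+ suc (suc N) *_) (binomialSum-absorbʳ N (f ∘ suc)) ⟩
    + suc (suc N) * (+ suc N * binomialSum N (f ∘ suc))
  ≡⟨ sym (ℤP.*-assoc (+ suc (suc N)) (+ suc N) _) ⟩
    + suc (suc N) * + suc N * binomialSum N (f ∘ suc)
  ∎
  where
  open ≡-Reasoning
  cancel : ∀ x y → (+ 1 + x) - (+ 1 + y) ≡ x - y
  cancel = solve-∀

binomial-theorem : ∀ (k : ℤ) N → (k + + 1) ^ℤ N ≡ binomialSum N (k ^ℤ_)
binomial-theorem k zero    = refl
binomial-theorem k (suc N) = begin
    (k + + 1) * (k + + 1) ^ℤ N
  ≡⟨ cong ((k + + 1) *_) (binomial-theorem k N) ⟩
    (k + + 1) * binomialSum N (k ^ℤ_)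
  ≡⟨ distrib k (binomialSum N (k ^ℤ_)) ⟩
    binomialSum N (k ^ℤ_) + k * binomialSum N (k ^ℤ_)
  ≡⟨ cong (λ t → binomialSum N (k ^ℤ_) + t) (sym (binomialSum-* N k (k ^ℤ_))) ⟩
    binomialSum N (k ^ℤ_) + binomialSum N ((k ^ℤ_) ∘ suc)
  ≡⟨ sym (binomialSum-pascal N (k ^ℤ_)) ⟩
    binomialSum (suc N) (k ^ℤ_)
  ∎
  where
  open ≡-Reasoning
  distrib : ∀ k a → (k + + 1) * a ≡ a + k * a
  distrib = solve-∀

centralSum : ℕ → (ℤ → ℤ) → ℤ
centralSum n p = binomialSum (2 ℕ.* n) (λ j → p (+ j - + n))

centralSum-cong : ∀ n {p q : ℤ → ℤ} → (∀ k → p k ≡ q k) → centralSum n p ≡ centralSum n q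
centralSum-cong n eq = binomialSum-cong (2 ℕ.* n) (λ j → eq (+ j - + n))

centralSum-+ : ∀ n (p q : ℤ → ℤ) → centralSum n (λ k → p k + q k) ≡ centralSum n p + centralSum n q
centralSum-+ n p q = binomialSum-+ (2 ℕ.* n) _ _

centralSum-- : ∀ n (p q : ℤ → ℤ) → centralSum n (λ k → p k - q k) ≡ centralSum n p - centralSum n q
centralSum-- n p q = binomialSum-- (2 ℕ.* n) _ _

centralSum-* : ∀ n c (p : ℤ → ℤ) → centralSum n (λ k → c * p k) ≡ c * centralSum n p
centralSum-* n c p = binomialSum-* (2 ℕ.* n) c _

binomℤ-centred : ∀ n j → j ℕ.≤ 2 ℕ.* n → binomℤ (2 ℕ.* n) (+ n - (- + n + + j)) ≡ + ((2 ℕ.* n) C j)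
binomℤ-centred n j j≤2n = begin
    binomℤ (2 ℕ.* n) (+ n - (- + n + + j))
  ≡⟨ cong (binomℤ (2 ℕ.* n)) (trans (reflect (+ n) (+ j)) (cong (_- + j) (sym (ℤP.pos-* 2 n)))) ⟩
    binomℤ (2 ℕ.* n) (+ (2 ℕ.* n) - + j)
  ≡⟨ cong (binomℤ (2 ℕ.* n)) (trans (ℤP.m-n≡m⊖n (2 ℕ.* n) j) (ℤP.⊖-≥ j≤2n)) ⟩
    + ((2 ℕ.* n) C (2 ℕ.* n ℕ.∸ j))
  ≡⟨ cong +_ (sym (nCk≡nC[n∸k] j≤2n)) ⟩
    + ((2 ℕ.* n) C j)
  ∎
  where
  open ≡-Reasoning
  reflect : ∀ a b → a - (- a + b) ≡ + 2 * a - b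
  reflect = solve-∀

sumSym≡centralSum : ∀ n p → sumSym n (λ k → binomℤ (2 ℕ.* n) (+ n - k) * p k) ≡ centralSum n p
sumSym≡centralSum n p =
  trans (sumFrom≡sumTo (- + n) (suc (2 ℕ.* n)) (λ k → binomℤ (2 ℕ.* n) (+ n - k) * p k))
        (sumTo-cong-< (suc (2 ℕ.* n)) (λ j j≤2n →
          cong₂ _*_ (binomℤ-centred n j (ℕP.≤-pred j≤2n)) (cong p (commute (+ n) (+ j)))))
  where
  commute : ∀ a b → - a + b ≡ b - a
  commute = solve-∀

centralSum-suc-unfold : ∀ m p → centralSum (suc m) p ≡ binomialSum (suc (suc (2 ℕ.* m))) (λ j → p (+ j - + suc m))
centralSum-suc-unfold m p = cong (λ N → binomialSum N (λ j → p (+ j - + suc m))) (ℕP.*-suc 2 m)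

two*suc : ∀ m → + suc (suc (2 ℕ.* m)) ≡ + 2 * + suc m
two*suc m = trans (cong +_ (sym (ℕP.*-suc 2 m))) (ℤP.pos-* 2 (suc m))

module _ (m : ℕ) (p : ℤ → ℤ) where

  private
    g : ℕ → ℤ
    g j = p (+ j - + suc m)

    below : binomialSum (2 ℕ.* m) g ≡ centralSum m (λ k → p (k - + 1))
    below = binomialSum-cong (2 ℕ.* m) (λ j → cong p (shift (+ j) (+ m)))
      where
      shift : ∀ a b → a - (+ 1 + b) ≡ a - b - + 1
      shift = solve-∀

    at : binomialSum (2 ℕ.* m) (g ∘ suc) ≡ centralSum m p
    at = binomialSum-cong (2 ℕ.* m) (λ j → cong p (shift (+ j) (+ m)))
      where
      shift : ∀ a b → (+ 1 + a) - (+ 1 + b) ≡ a - b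
      shift = solve-∀

    above : binomialSum (2 ℕ.* m) (g ∘ suc ∘ suc) ≡ centralSum m (λ k → p (k + + 1))
    above = binomialSum-cong (2 ℕ.* m) (λ j → cong p (shift (+ j) (+ m)))
      where
      shift : ∀ a b → (+ 1 + (+ 1 + a)) - (+ 1 + b) ≡ a - b + + 1
      shift = solve-∀

  centralSum-suc : centralSum (suc m) p ≡ centralSum m (λ k → p (k - + 1) + + 2 * p k + p (k + + 1))
  centralSum-suc = begin
      centralSum (suc m) p
    ≡⟨ centralSum-suc-unfold m p ⟩
      binomialSum (suc (suc (2 ℕ.* m))) g
    ≡⟨ binomialSum-pascal² (2 ℕ.* m) g ⟩
      binomialSum (2 ℕ.* m) g + + 2 * binomialSum (2 ℕ.* m) (g ∘ suc) + binomialSum (2 ℕ.* m) (g ∘ suc ∘ suc)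
    ≡⟨ cong₂ _+_ (cong₂ (λ x y → x + + 2 * y) below at) above ⟩
      centralSum m (λ k → p (k - + 1)) + + 2 * centralSum m p + centralSum m (λ k → p (k + + 1))
    ≡⟨ sym (trans (centralSum-+ m (λ k → p (k - + 1) + + 2 * p k) (λ k → p (k + + 1)))
         (cong (_+ centralSum m (λ k → p (k + + 1))) (trans (centralSum-+ m (λ k → p (k - + 1)) (λ k → + 2 * p k))
           (cong (λ t → centralSum m (λ k → p (k - + 1)) + t) (centralSum-* m (+ 2) p))))) ⟩
      centralSum m (λ k → p (k - + 1) + + 2 * p k + p (k + + 1))
    ∎
    where open ≡-Reasoning

  centralSum-suc-k* : centralSum (suc m) (λ k → k * p k) ≡ + suc m * centralSum m (λ k → p (k + + 1) - p (k - + 1))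
  centralSum-suc-k* = begin
      centralSum (suc m) (λ k → k * p k)
    ≡⟨ centralSum-suc-unfold m (λ k → k * p k) ⟩
      binomialSum (suc (suc (2 ℕ.* m))) (λ j → (+ j - + suc m) * g j)
    ≡⟨ binomialSum-cong (suc (suc (2 ℕ.* m))) (λ j → distrib (+ j) (+ suc m) (g j)) ⟩
      binomialSum (suc (suc (2 ℕ.* m))) (λ j → + j * g j - + suc m * g j)
    ≡⟨ trans (binomialSum-- (suc (suc (2 ℕ.* m))) (λ j → + j * g j) (λ j → + suc m * g j)) (cong₂ _-_
         (binomialSum-absorb (suc (2 ℕ.* m)) g) (binomialSum-* (suc (suc (2 ℕ.* m))) (+ suc m) g)) ⟩
      + suc (suc (2 ℕ.* m)) * binomialSum (suc (2 ℕ.* m)) (g ∘ suc) - + suc m * binomialSum (suc (suc (2 ℕ.* m))) g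
    ≡⟨ cong₂ (λ x y → x * y - + suc m * binomialSum (suc (suc (2 ℕ.* m))) g)
         (two*suc m) (binomialSum-pascal (2 ℕ.* m) (g ∘ suc)) ⟩
      + 2 * + suc m * (b + c) - + suc m * binomialSum (suc (suc (2 ℕ.* m))) g
    ≡⟨ cong (λ t → + 2 * + suc m * (b + c) - + suc m * t) (binomialSum-pascal² (2 ℕ.* m) g) ⟩
      + 2 * + suc m * (b + c) - + suc m * (a + + 2 * b + c)
    ≡⟨ collect (+ suc m) a b c ⟩
      + suc m * (c - a)
    ≡⟨ cong (+ suc m *_) (trans (cong₂ _-_ above below) (sym (centralSum-- m (λ k → p (k + + 1)) (λ k → p (k - + 1))))) ⟩
      + suc m * centralSum m (λ k → p (k + + 1) - p (k - + 1))
    ∎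
    where
    open ≡-Reasoning
    a = binomialSum (2 ℕ.* m) g
    b = binomialSum (2 ℕ.* m) (g ∘ suc)
    c = binomialSum (2 ℕ.* m) (g ∘ suc ∘ suc)
    distrib : ∀ x y z → (x - y) * z ≡ x * z - y * z
    distrib = solve-∀
    collect : ∀ n a b c → + 2 * n * (b + c) - n * (a + + 2 * b + c) ≡ n * (c - a)
    collect = solve-∀

  -- With n = suc m and j = k + n, the weight n² − k² factors as j (2n − j).
  centralSum-suc-k*k* : centralSum (suc m) (λ k → k * (k * p k))
    ≡ + suc m * + suc m * centralSum (suc m) p - + suc (suc (2 ℕ.* m)) * + suc (2 ℕ.* m) * centralSum m p
  centralSum-suc-k*k* = begin
      centralSum (suc m) (λ k → k * (k * p k))
    ≡⟨ centralSum-suc-unfold m (λ k → k * (k * p k)) ⟩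
      binomialSum (suc (suc (2 ℕ.* m))) (λ j → (+ j - + suc m) * ((+ j - + suc m) * g j))
    ≡⟨ binomialSum-cong (suc (suc (2 ℕ.* m))) (λ j → trans (square-difference (+ j) (+ suc m) (g j))
         (cong (λ t → + suc m * + suc m * g j - + j * ((t - + j) * g j)) (sym (two*suc m)))) ⟩
      binomialSum (suc (suc (2 ℕ.* m))) (λ j → + suc m * + suc m * g j - + j * ((+ suc (suc (2 ℕ.* m)) - + j) * g j))
    ≡⟨ trans (binomialSum-- (suc (suc (2 ℕ.* m))) (λ j → + suc m * + suc m * g j) (λ j → + j * ((+ suc (suc (2 ℕ.* m)) - + j) * g j))) (cong₂ _-_
         (binomialSum-* (suc (suc (2 ℕ.* m))) (+ suc m * + suc m) g) (binomialSum-falling (2 ℕ.* m) g)) ⟩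
      + suc m * + suc m * binomialSum (suc (suc (2 ℕ.* m))) g - + suc (suc (2 ℕ.* m)) * + suc (2 ℕ.* m) * binomialSum (2 ℕ.* m) (g ∘ suc)
    ≡⟨ cong₂ (λ x y → + suc m * + suc m * x - + suc (suc (2 ℕ.* m)) * + suc (2 ℕ.* m) * y) (sym (centralSum-suc-unfold m p)) at ⟩
      + suc m * + suc m * centralSum (suc m) p - + suc (suc (2 ℕ.* m)) * + suc (2 ℕ.* m) * centralSum m p
    ∎
    where
    open ≡-Reasoning
    square-difference : ∀ j n x → (j - n) * ((j - n) * x) ≡ n * n * x - j * ((+ 2 * n - j) * x)
    square-difference = solve-∀

Even Odd : (ℤ → ℤ) → Set
Even p = ∀ k → p (- k) ≡ p k
Odd  p = ∀ k → p (- k) ≡ - p k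

x≡-x⇒x≡0 : ∀ {x} → x ≡ - x → x ≡ + 0
x≡-x⇒x≡0 {+ zero}   _ = refl
x≡-x⇒x≡0 {+ suc n}  ()
x≡-x⇒x≡0 { -[1+ n ]} ()

centralSum-odd : ∀ n p → Odd p → centralSum n p ≡ + 0
centralSum-odd zero    p odd rewrite x≡-x⇒x≡0 (odd (+ 0)) = refl
centralSum-odd (suc m) p odd = trans (centralSum-suc m p) (centralSum-odd m _ stencil-odd)
  where
  open ≡-Reasoning
  neg-pred : ∀ k → - k - + 1 ≡ - (k + + 1)
  neg-pred = solve-∀
  neg-suc : ∀ k → - k + + 1 ≡ - (k - + 1)
  neg-suc = solve-∀
  negate : ∀ a b c → - a + + 2 * - b + - c ≡ - (c + + 2 * b + a)
  negate = solve-∀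
  stencil-odd : Odd (λ k → p (k - + 1) + + 2 * p k + p (k + + 1))
  stencil-odd k = begin
      p (- k - + 1) + + 2 * p (- k) + p (- k + + 1)
    ≡⟨ cong₂ _+_ (cong₂ (λ x y → x + + 2 * y) (trans (cong p (neg-pred k)) (odd (k + + 1))) (odd k))
                 (trans (cong p (neg-suc k)) (odd (k - + 1))) ⟩
      - p (k + + 1) + + 2 * - p k + - p (k - + 1)
    ≡⟨ negate (p (k + + 1)) (p k) (p (k - + 1)) ⟩
      - (p (k - + 1) + + 2 * p k + p (k + + 1))
    ∎

odd-k* : ∀ p → Even p → Odd (λ k → k * p k)
odd-k* p even k = trans (cong (- k *_) (even k)) (sym (ℤP.neg-distribˡ-* k (p k)))

centralSum-even-difference : ∀ m p → Even p →
  centralSum m (λ k → p (k + + 2) - p k) ≡ centralSum (suc m) (λ k → p (k + + 1)) - centralSum (suc m) p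
centralSum-even-difference m p even = begin
    centralSum m (λ k → p (k + + 2) - p k)
  ≡⟨ sym (ℤP.+-identityʳ _) ⟩
    centralSum m (λ k → p (k + + 2) - p k) + + 0
  ≡⟨ cong (λ t → centralSum m (λ k → p (k + + 2) - p k) + t)
       (sym (centralSum-odd m (λ k → p (k + + 1) - p (k - + 1)) antisymmetric-difference)) ⟩
    centralSum m (λ k → p (k + + 2) - p k) + centralSum m (λ k → p (k + + 1) - p (k - + 1))
  ≡⟨ sym (centralSum-+ m (λ k → p (k + + 2) - p k) (λ k → p (k + + 1) - p (k - + 1))) ⟩
    centralSum m (λ k → (p (k + + 2) - p k) + (p (k + + 1) - p (k - + 1)))
  ≡⟨ centralSum-cong m (λ k → trans (collect (p (k + + 2)) (p (k + + 1)) (p k) (p (k - + 1)))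
       (cong₂ (λ x y → x + + 2 * p (k + + 1) + y - (p (k - + 1) + + 2 * p k + p (k + + 1)))
         (cong p (pred-suc k)) (cong p (suc-suc k)))) ⟩
    centralSum m (λ k → (p (k - + 1 + + 1) + + 2 * p (k + + 1) + p (k + + 1 + + 1)) - (p (k - + 1) + + 2 * p k + p (k + + 1)))
  ≡⟨ centralSum-- m (λ k → p (k - + 1 + + 1) + + 2 * p (k + + 1) + p (k + + 1 + + 1)) (λ k → p (k - + 1) + + 2 * p k + p (k + + 1)) ⟩
    centralSum m (λ k → p (k - + 1 + + 1) + + 2 * p (k + + 1) + p (k + + 1 + + 1)) - centralSum m (λ k → p (k - + 1) + + 2 * p k + p (k + + 1))
  ≡⟨ sym (cong₂ _-_ (centralSum-suc m (λ k → p (k + + 1))) (centralSum-suc m p)) ⟩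
    centralSum (suc m) (λ k → p (k + + 1)) - centralSum (suc m) p
  ∎
  where
  open ≡-Reasoning
  pred-suc : ∀ k → k ≡ k - + 1 + + 1
  pred-suc = solve-∀
  suc-suc : ∀ k → k + + 2 ≡ k + + 1 + + 1
  suc-suc = solve-∀
  collect : ∀ a b c d → (a - c) + (b - d) ≡ c + + 2 * b + a - (d + + 2 * c + b)
  collect = solve-∀
  antisymmetric-difference : Odd (λ k → p (k + + 1) - p (k - + 1))
  antisymmetric-difference k = begin
      p (- k + + 1) - p (- k - + 1)
    ≡⟨ cong₂ _-_ (trans (cong p (neg-pred k)) (even (k - + 1))) (trans (cong p (neg-suc k)) (even (k + + 1))) ⟩
      p (k - + 1) - p (k + + 1)
    ≡⟨ swap (p (k + + 1)) (p (k - + 1)) ⟩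
      - (p (k + + 1) - p (k - + 1))
    ∎
    where
    neg-pred : ∀ k → - k + + 1 ≡ - (k - + 1)
    neg-pred = solve-∀
    neg-suc : ∀ k → - k - + 1 ≡ - (k + + 1)
    neg-suc = solve-∀
    swap : ∀ a b → b - a ≡ - (a - b)
    swap = solve-∀

sumTo-centralSum : ∀ n r (c : ℕ → ℤ) (p : ℕ → ℤ → ℤ) →
  sumTo r (λ i → c i * centralSum n (p i)) ≡ centralSum n (λ k → sumTo r (λ i → c i * p i k))
sumTo-centralSum n zero    c p = sym (centralSum-* n (+ 0) (λ _ → + 0))
sumTo-centralSum n (suc r) c p =
  trans (cong₂ _+_ (sumTo-centralSum n r c p) (sym (centralSum-* n (c r) (p r))))
        (sym (centralSum-+ n (λ k → sumTo r (λ i → c i * p i k)) (λ k → c r * p r k)))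

evenPow : ℕ → ℤ → ℤ
evenPow r k = k ^ℤ (2 ℕ.* r)

evenPow-even : ∀ r → Even (evenPow r)
evenPow-even r k = begin
    (- k) ^ℤ (2 ℕ.* r)
  ≡⟨ sym (ℤP.^-*-assoc (- k) 2 r) ⟩
    ((- k) ^ℤ 2) ^ℤ r
  ≡⟨ cong (_^ℤ r) (square-neg k) ⟩
    (k ^ℤ 2) ^ℤ r
  ≡⟨ ℤP.^-*-assoc k 2 r ⟩
    k ^ℤ (2 ℕ.* r)
  ∎
  where
  open ≡-Reasoning
  square-neg : ∀ k → - k * (- k * + 1) ≡ k * (k * + 1)
  square-neg = solve-∀

F≡centralSum : ∀ n r → F n r ≡ centralSum n (evenPow r)
F≡centralSum n r = sumSym≡centralSum n (evenPow r)

sumTo-F : ∀ n r (c : ℕ → ℤ) → sumTo r (λ i → c i * F n i) ≡ centralSum n (λ k → sumTo r (λ i → c i * evenPow i k))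
sumTo-F n r c = trans (sumTo-cong r (λ i → cong (c i *_) (F≡centralSum n i))) (sumTo-centralSum n r c evenPow)

binomEven binomOdd : ℕ → ℤ → ℤ
binomEven r k = sumTo r (λ i → + ((2 ℕ.* r) C (2 ℕ.* i)) * evenPow i k)
binomOdd  r k = sumTo r (λ i → + ((2 ℕ.* r) C suc (2 ℕ.* i)) * evenPow i k)

binomEven-even : ∀ r → Even (binomEven r)
binomEven-even r k = sumTo-cong r (λ i → cong (+ ((2 ℕ.* r) C (2 ℕ.* i)) *_) (evenPow-even i k))

binomOdd-even : ∀ r → Even (binomOdd r)
binomOdd-even r k = sumTo-cong r (λ i → cong (+ ((2 ℕ.* r) C suc (2 ℕ.* i)) *_) (evenPow-even i k))

evenPow-suc : ∀ r k → evenPow r (k + + 1) ≡ binomEven r k + evenPow r k + k * binomOdd r k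
evenPow-suc r k = begin
    (k + + 1) ^ℤ (2 ℕ.* r)
  ≡⟨ binomial-theorem k (2 ℕ.* r) ⟩
    sumTo (2 ℕ.* r) h + + ((2 ℕ.* r) C (2 ℕ.* r)) * evenPow r k
  ≡⟨ cong₂ _+_ (trans (sumTo-pairs r h) (sumTo-+ r (λ i → h (2 ℕ.* i)) (λ i → h (suc (2 ℕ.* i)))))
       (trans (cong (λ c → + c * evenPow r k) (nCn≡1 (2 ℕ.* r))) (ℤP.*-identityˡ (evenPow r k))) ⟩
    binomEven r k + sumTo r (λ i → h (suc (2 ℕ.* i))) + evenPow r k
  ≡⟨ cong (λ t → binomEven r k + t + evenPow r k)
       (trans (sumTo-cong r (λ i → swap (+ ((2 ℕ.* r) C suc (2 ℕ.* i))) k (evenPow i k)))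
              (sumTo-* r k (λ i → + ((2 ℕ.* r) C suc (2 ℕ.* i)) * evenPow i k))) ⟩
    binomEven r k + k * binomOdd r k + evenPow r k
  ≡⟨ reorder (binomEven r k) (k * binomOdd r k) (evenPow r k) ⟩
    binomEven r k + evenPow r k + k * binomOdd r k
  ∎
  where
  open ≡-Reasoning
  h : ℕ → ℤ
  h j = + ((2 ℕ.* r) C j) * k ^ℤ j
  swap : ∀ a k b → a * (k * b) ≡ k * (a * b)
  swap = solve-∀
  reorder : ∀ a b c → a + b + c ≡ a + c + b
  reorder = solve-∀

evenPow-pred : ∀ r k → evenPow r (k - + 1) ≡ binomEven r k + evenPow r k - k * binomOdd r k
evenPow-pred r k = begin
    evenPow r (k - + 1)
  ≡⟨ trans (sym (evenPow-even r (k - + 1))) (cong (evenPow r) (negate k)) ⟩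
    evenPow r (- k + + 1)
  ≡⟨ evenPow-suc r (- k) ⟩
    binomEven r (- k) + evenPow r (- k) + - k * binomOdd r (- k)
  ≡⟨ cong₂ (λ x y → x + y + - k * binomOdd r (- k)) (binomEven-even r k) (evenPow-even r k) ⟩
    binomEven r k + evenPow r k + - k * binomOdd r (- k)
  ≡⟨ cong (λ t → binomEven r k + evenPow r k + - k * t) (binomOdd-even r k) ⟩
    binomEven r k + evenPow r k + - k * binomOdd r k
  ≡⟨ cong (λ t → binomEven r k + evenPow r k + t) (sym (ℤP.neg-distribˡ-* k (binomOdd r k))) ⟩
    binomEven r k + evenPow r k - k * binomOdd r k
  ∎
  where
  open ≡-Reasoning
  negate : ∀ k → - (k - + 1) ≡ - k + + 1
  negate = solve-∀

centralSum-evenPow-suc : ∀ m r →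
  centralSum (suc m) (evenPow r) ≡ + 4 * centralSum m (evenPow r) + + 2 * centralSum m (binomEven r)
centralSum-evenPow-suc m r = begin
    centralSum (suc m) (evenPow r)
  ≡⟨ centralSum-suc m (evenPow r) ⟩
    centralSum m (λ k → evenPow r (k - + 1) + + 2 * evenPow r k + evenPow r (k + + 1))
  ≡⟨ centralSum-cong m (λ k → trans (cong₂ (λ x y → x + + 2 * evenPow r k + y) (evenPow-pred r k) (evenPow-suc r k))
       (collect (binomEven r k) (evenPow r k) (k * binomOdd r k))) ⟩
    centralSum m (λ k → + 4 * evenPow r k + + 2 * binomEven r k)
  ≡⟨ trans (centralSum-+ m (λ k → + 4 * evenPow r k) (λ k → + 2 * binomEven r k))
       (cong₂ _+_ (centralSum-* m (+ 4) (evenPow r)) (centralSum-* m (+ 2) (binomEven r))) ⟩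
    + 4 * centralSum m (evenPow r) + + 2 * centralSum m (binomEven r)
  ∎
  where
  open ≡-Reasoning
  collect : ∀ e q x → e + q - x + + 2 * q + (e + q + x) ≡ + 4 * q + + 2 * e
  collect = solve-∀

centralSum-binomEven : ∀ n r →
  centralSum n (binomEven r) ≡ centralSum n (λ k → evenPow r (k + + 1)) - centralSum n (evenPow r)
centralSum-binomEven n r = begin
    centralSum n (binomEven r)
  ≡⟨ centralSum-cong n isolate ⟩
    centralSum n (λ k → evenPow r (k + + 1) - evenPow r k - k * binomOdd r k)
  ≡⟨ centralSum-- n (λ k → evenPow r (k + + 1) - evenPow r k) (λ k → k * binomOdd r k) ⟩
    centralSum n (λ k → evenPow r (k + + 1) - evenPow r k) - centralSum n (λ k → k * binomOdd r k)
  ≡⟨ cong₂ _-_ (centralSum-- n (λ k → evenPow r (k + + 1)) (evenPow r))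
       (centralSum-odd n (λ k → k * binomOdd r k) (odd-k* (binomOdd r) (binomOdd-even r))) ⟩
    centralSum n (λ k → evenPow r (k + + 1)) - centralSum n (evenPow r) - + 0
  ≡⟨ ℤP.+-identityʳ _ ⟩
    centralSum n (λ k → evenPow r (k + + 1)) - centralSum n (evenPow r)
  ∎
  where
  open ≡-Reasoning
  isolate : ∀ k → binomEven r k ≡ evenPow r (k + + 1) - evenPow r k - k * binomOdd r k
  isolate k = trans (solve (binomEven r k) (evenPow r k) (k * binomOdd r k))
    (cong (λ t → t - evenPow r k - k * binomOdd r k) (sym (evenPow-suc r k)))
    where
    solve : ∀ e q x → e ≡ e + q + x - q - x
    solve = solve-∀

centralSum-k*k*binomOdd : ∀ m r →
  centralSum (suc m) (λ k → k * (k * binomOdd r k)) ≡ + suc m * centralSum m (λ k → evenPow r (k + + 2) - evenPow r k)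
centralSum-k*k*binomOdd m r = begin
    centralSum (suc m) (λ k → k * (k * binomOdd r k))
  ≡⟨ centralSum-cong (suc m) isolate ⟩
    centralSum (suc m) (λ k → k * P k - k * binomEven r k - k * evenPow r k)
  ≡⟨ trans (centralSum-- (suc m) (λ k → k * P k - k * binomEven r k) (λ k → k * evenPow r k))
       (cong₂ _-_ (centralSum-- (suc m) (λ k → k * P k) (λ k → k * binomEven r k))
         (centralSum-odd (suc m) (λ k → k * evenPow r k) (odd-k* (evenPow r) (evenPow-even r)))) ⟩
    centralSum (suc m) (λ k → k * P k) - centralSum (suc m) (λ k → k * binomEven r k) - + 0
  ≡⟨ cong (λ t → centralSum (suc m) (λ k → k * P k) - t - + 0)
       (centralSum-odd (suc m) (λ k → k * binomEven r k) (odd-k* (binomEven r) (binomEven-even r))) ⟩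
    centralSum (suc m) (λ k → k * P k) - + 0 - + 0
  ≡⟨ drop-zeros (centralSum (suc m) (λ k → k * P k)) ⟩
    centralSum (suc m) (λ k → k * P k)
  ≡⟨ centralSum-suc-k* m P ⟩
    + suc m * centralSum m (λ k → P (k + + 1) - P (k - + 1))
  ≡⟨ cong (+ suc m *_) (centralSum-cong m (λ k → cong₂ (λ x y → evenPow r x - evenPow r y) (suc-suc k) (pred-suc k))) ⟩
    + suc m * centralSum m (λ k → evenPow r (k + + 2) - evenPow r k)
  ∎
  where
  open ≡-Reasoning
  P : ℤ → ℤ
  P k = evenPow r (k + + 1)
  isolate : ∀ k → k * (k * binomOdd r k) ≡ k * P k - k * binomEven r k - k * evenPow r k
  isolate k = trans (solve k (binomEven r k) (evenPow r k) (binomOdd r k))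
    (cong (λ t → k * t - k * binomEven r k - k * evenPow r k) (sym (evenPow-suc r k)))
    where
    solve : ∀ k e q x → k * (k * x) ≡ k * (e + q + k * x) - k * e - k * q
    solve = solve-∀
  drop-zeros : ∀ a → a - + 0 - + 0 ≡ a
  drop-zeros = solve-∀
  suc-suc : ∀ k → k + + 1 + + 1 ≡ k + + 2
  suc-suc = solve-∀
  pred-suc : ∀ k → k - + 1 + + 1 ≡ k
  pred-suc = solve-∀

binomOdd-recurrence : ∀ m r → + suc m * centralSum (suc m) (binomOdd r)
  ≡ centralSum (suc m) (binomEven r) + + 2 * + suc (2 ℕ.* m) * centralSum m (binomOdd r)
binomOdd-recurrence m r = ℤP.*-cancelˡ-≡ (+ suc m) _ _ (rearrange (+ suc m) qₙ (+ suc (2 ℕ.* m)) qₘ eₙ moments)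
  where
  open ≡-Reasoning
  qₙ = centralSum (suc m) (binomOdd r)
  qₘ = centralSum m (binomOdd r)
  eₙ = centralSum (suc m) (binomEven r)
  moments : + suc m * + suc m * qₙ - + 2 * + suc m * + suc (2 ℕ.* m) * qₘ ≡ + suc m * eₙ
  moments = begin
      + suc m * + suc m * qₙ - + 2 * + suc m * + suc (2 ℕ.* m) * qₘ
    ≡⟨ cong (λ t → + suc m * + suc m * qₙ - t * + suc (2 ℕ.* m) * qₘ) (sym (two*suc m)) ⟩
      + suc m * + suc m * qₙ - + suc (suc (2 ℕ.* m)) * + suc (2 ℕ.* m) * qₘ
    ≡⟨ sym (centralSum-suc-k*k* m (binomOdd r)) ⟩
      centralSum (suc m) (λ k → k * (k * binomOdd r k))
    ≡⟨ centralSum-k*k*binomOdd m r ⟩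
      + suc m * centralSum m (λ k → evenPow r (k + + 2) - evenPow r k)
    ≡⟨ cong (+ suc m *_) (centralSum-even-difference m (evenPow r) (evenPow-even r)) ⟩
      + suc m * (centralSum (suc m) (λ k → evenPow r (k + + 1)) - centralSum (suc m) (evenPow r))
    ≡⟨ cong (+ suc m *_) (sym (centralSum-binomEven (suc m) r)) ⟩
      + suc m * eₙ
    ∎
  rearrange : ∀ n a s b e → n * n * a - + 2 * n * s * b ≡ n * e → n * (n * a) ≡ n * (e + + 2 * s * b)
  rearrange n a s b e eq = trans (split n a s b) (trans (cong (λ t → t + + 2 * n * s * b) eq) (merge n s b e))
    where
    split : ∀ n a s b → n * (n * a) ≡ n * n * a - + 2 * n * s * b + + 2 * n * s * b
    split = solve-∀
    merge : ∀ n s b e → n * e + + 2 * n * s * b ≡ n * (e + + 2 * s * b)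
    merge = solve-∀

rearrange-recurrence : ∀ {X Y A s B n C D Y′ A′ s′ B′ C′ D′} →
  X ≡ + 4 * Y + + 2 * D → n * C ≡ A + + 2 * s * B →
  Y′ ≡ Y → A′ ≡ A → s′ ≡ s → B′ ≡ B → C′ ≡ C → D′ ≡ D →
  X ≡ + 4 * Y′ - A′ - + 2 * s′ * B′ + n * C′ + + 2 * D′
rearrange-recurrence {Y = Y} {A} {s} {B} {n} {C} {D} refl eq refl refl refl refl refl refl =
  trans (solve Y A s B D) (cong (λ t → + 4 * Y - A - + 2 * s * B + t + + 2 * D) (sym eq))
  where
  solve : ∀ Y A s B D → + 4 * Y + + 2 * D ≡ + 4 * Y - A - + 2 * s * B + (A + + 2 * s * B) + + 2 * D
  solve = solve-∀

lemma3p1 : (n r : ℕ) → ℕ.NonZero n → ℕ.NonZero r →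
    F n r ≡
      + 4 * F (n ℕ.∸ 1) r
      - sumTo r (λ i → + ((2 ℕ.* r) C (2 ℕ.* i)) * F n i)
      - + 2 * + (2 ℕ.* n ℕ.∸ 1) * sumTo r (λ i → + ((2 ℕ.* r) C (suc (2 ℕ.* i))) * F (n ℕ.∸ 1) i)
      + + n * sumTo r (λ i → + ((2 ℕ.* r) C (suc (2 ℕ.* i))) * F n i)
      + + 2 * sumTo r (λ i → + ((2 ℕ.* r) C (2 ℕ.* i)) * F (n ℕ.∸ 1) i)
lemma3p1 (suc m) r _ _ =
  trans (F≡centralSum (suc m) r)
    (rearrange-recurrence {n = + suc m} (centralSum-evenPow-suc m r) (binomOdd-recurrence m r)
      (F≡centralSum m r) (sumTo-F (suc m) r evenIndex) (cong (λ N → + (N ℕ.∸ 1)) (ℕP.*-suc 2 m))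
      (sumTo-F m r oddIndex) (sumTo-F (suc m) r oddIndex) (sumTo-F m r evenIndex))
  where
  evenIndex oddIndex : ℕ → ℤ
  evenIndex i = + ((2 ℕ.* r) C (2 ℕ.* i))
  oddIndex  i = + ((2 ℕ.* r) C suc (2 ℕ.* i))
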